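{- Let $T$ be any (finite) tree and let $k\geq 1$ be an integer. Then $\mathrm{box}(T^k)\leq k+1$.
   Context: All graphs are simple, undirected and finite. For a graph $G$, $G^k$ denotes the graph on $V(G)$ in which $u\neq v$ are adjacent iff their distance in $G$ is at most $k$. An axis-parallel $t$-dimensional box is a Cartesian product $R_1\times\cdots\times R_t$ of closed real intervals. The boxicity $\mathrm{box}(G)$ of a graph $G$ is the minimum integer $t$ such that $G$ is the intersection graph of axis-parallel $t$-dimensional boxes, i.e. there is a map $f$ from $V(G)$ to $t$-dimensional boxes with $(u,v)\in E(G)\iff f(u)\cap f(v)\neq\emptyset$ for distinct $u,v$. -}

module Defs where

open import Level using (0ℓ)
open import Data.Nat using (ℕ; zero; suc; _≤_; _+_)
open import Data.Fin using (Fin; zero; suc; inject₁; fromℕ)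
open import Data.Product using (Σ; ∃; ∃-syntax; _×_; _,_)
open import Data.Rational using (ℚ) renaming (_≤_ to _≤ℚ_)
open import Relation.Binary.PropositionalEquality using (_≡_; _≢_)
open import Relation.Nullary using (¬_)
open import Function.Definitions using (Injective)
open import Data.Nat.Properties using (+-suc; +-identityʳ)

record Graph (n : ℕ) : Set₁ where
  field
    Adj     : Fin n → Fin n → Set
    symm    : ∀ {u v} → Adj u v → Adj v u
    irrefl  : ∀ {u} → ¬ Adj u u
open Graph public

data Walk {n : ℕ} (G : Graph n) : Fin n → Fin n → ℕ → Set where
  here : ∀ {u} → Walk G u u zero
  step : ∀ {u w v ℓ} → Adj G u w → Walk G w v ℓ → Walk G u v (suc ℓ)

DistAtMost : ∀ {n} → Graph n → ℕ → Fin n → Fin n → Set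
DistAtMost G k u v = ∃[ ℓ ] (ℓ ≤ k × Walk G u v ℓ)

Connected : ∀ {n} → Graph n → Set
Connected {n} G = ∀ (u v : Fin n) → ∃[ ℓ ] Walk G u v ℓ

record Cycle {n : ℕ} (G : Graph n) : Set where
  field
    m      : ℕ
    c      : Fin (suc (suc (suc m))) → Fin n
    inj    : Injective _≡_ _≡_ c
    edges  : ∀ (i : Fin (suc (suc m))) → Adj G (c (inject₁ i)) (c (suc i))
    close  : Adj G (c (fromℕ (suc (suc m)))) (c zero)

Acyclic : ∀ {n} → Graph n → Set
Acyclic G = ¬ Cycle G

IsTree : ∀ {n} → Graph n → Set
IsTree {n} G = (1 ≤ n) × Connected G × Acyclic G

power : ∀ {n} → Graph n → ℕ → Graph n
power {n} G k = record
  { Adj    = λ u v → (u ≢ v) × DistAtMost G k u v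
  ; symm   = λ { (u≢v , ℓ , ℓ≤k , w) → (λ e → u≢v (sym' e)) , ℓ , ℓ≤k , wsubst (+-identityʳ _) (rev w here) }
  ; irrefl = λ { (u≢u , _) → u≢u _≡_.refl }
  }
  where
  wsubst : ∀ {a b x y} → x ≡ y → Walk G a b x → Walk G a b y
  wsubst _≡_.refl w = w
  sym' : ∀ {a b : Fin n} → a ≡ b → b ≡ a
  sym' _≡_.refl = _≡_.refl
  rev : ∀ {a b ℓ₁ s ℓ₂} → Walk G a b ℓ₁ → Walk G a s ℓ₂ → Walk G b s (ℓ₁ + ℓ₂)
  rev here acc = acc
  rev {ℓ₁ = suc ℓ₁} {ℓ₂ = ℓ₂} (step e w) acc =
    wsubst (+-suc ℓ₁ ℓ₂) (rev w (step (symm G e) acc))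

-- Closed real intervals are represented with rational endpoints.
-- A t-dimensional axis-parallel box: for each coordinate a pair (lo , hi), lo ≤ hi.
record Box (t : ℕ) : Set where
  field
    lo hi  : Fin t → ℚ
    wf     : ∀ i → lo i ≤ℚ hi i
open Box public

InBox : ∀ {t} → (Fin t → ℚ) → Box t → Set
InBox x B = ∀ i → (lo B i ≤ℚ x i) × (x i ≤ℚ hi B i)

BoxesMeet : ∀ {t} → Box t → Box t → Set
BoxesMeet {t} B C = ∃[ x ] (InBox {t} x B × InBox x C)

BoxRepresentation : ∀ {n} → Graph n → (t : ℕ) → Set
BoxRepresentation {n} G t =
  Σ (Fin n → Box t) λ f →
    ∀ (u v : Fin n) → u ≢ v → (Adj G u v → BoxesMeet (f u) (f v)) × (BoxesMeet (f u) (f v) → Adj G u v)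

BoxicityAtMost : ∀ {n} → Graph n → ℕ → Set
BoxicityAtMost G t = ∃[ d ] (d ≤ t × BoxRepresentation G d)

module Submission where

-- Root T and record each vertex v by its root path π(v).  Compared
-- lexicographically (vertex names as digits), root paths list the vertices
-- in depth-first preorder, and π(a) followed by a sentinel larger than every
-- vertex is the end of the subtree of a.  Give v the box whose coordinate 0
-- is [depth v , depth v + k] and whose coordinate t + 1 (t < k) runs from
-- π of the t-th ancestor of v to the end of the subtree of its
-- (k - 1 - t)-th ancestor.  With C the common prefix of π(u) = C ++ P and
-- π(v) = C ++ Q, dist(u , v) = |P| + |Q|, and the boxes of u and v meet iff
-- this is at most k.  Lexicographic keys are turned into naturals by
-- ranking them among all right endpoints, naturals into rationals.

open import Defs
open import Data.Nat as ℕ using (ℕ; zero; suc; _≤_; _<_; _+_; _∸_; _⊔_; z≤n; s≤s; _≤?_)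
open import Data.Nat.Properties
  using (m≤n⇒m≤1+n; m≤m⊔n; m≤n⊔m; ⊔-lub; ∸-monoˡ-≤; +-monoʳ-≤; m+n∸n≡m; m<m+n; m<n⇒0<n∸m;
        +-∸-assoc; <⇒≤; module ≤-Reasoning; <-asym; <-irrefl; <-strictTotalOrder; +-cancelʳ-≤;
        ≤-trans; ≰⇒>; +-comm; ≤-refl; m≤n+m; n≤1+n; +-identityʳ; ≤-reflexive; +-suc;
        m+[n∸m]≡n; +-cancelʳ-<; m∸n+n≡m; n∸n≡0; m≤m+n; +-assoc; +-cancelˡ-≤; <⇒≱; <-cmp)
import Data.Nat.Coprimality as Coprime
open import Data.Integer as ℤ using (+_)
import Data.Integer.Properties as ℤ
open import Data.Rational using (ℚ; mkℚ; *≤*) renaming (_≤_ to _≤ℚ_)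
import Data.Rational.Properties as ℚ
open import Data.Fin as Fin using (Fin; toℕ)
open import Data.Fin.Properties using (toℕ<n; toℕ-fromℕ<; toℕ-injective)
open import Data.List
  using (List; []; _∷_; _++_; [_]; length; take; drop; map; lookup; initLast; _∷ʳ′_;
         cartesianProductWith; allFin)
open import Data.List.Properties
  using (++-assoc; take++drop≡id; length-++; ∷-injectiveˡ; ∷-injectiveʳ; length-++-comm; map-++;
         length-map; ++-identityʳ)
open import Data.List.Relation.Unary.All as All using (All; []; _∷_)
import Data.List.Relation.Unary.All.Properties as AllP
open import Data.List.Membership.Propositional using (_∈_; _∉_)
open import Data.List.Membership.Propositional.Properties
  using (∈-++⁺ˡ; ∈-++⁻; ∈-lookup; ∈-∃++; ∈-allFin; ∈-cartesianProductWith⁺)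
import Data.List.Membership.DecPropositional as DecMembership
open import Data.List.Relation.Unary.Any using (here; there)
open import Data.List.Relation.Binary.Lex.Strict as Lex using (Lex-<; this; next)
open import Data.Product using (∃-syntax; _×_; _,_; proj₁; proj₂)
open import Data.Sum using (_⊎_; inj₁; inj₂)
open import Data.Empty using (⊥; ⊥-elim)
open import Data.Unit using (⊤; tt)
open import Function using (_∘_)
open import Function.Definitions using (Injective)
open import Relation.Nullary using (¬_; yes; no; contradiction)
open import Relation.Binary using (StrictTotalOrder; DecidableEquality; tri<; tri≈; tri>)
open import Relation.Binary.PropositionalEquality hiding ([_])

ℕ→ℚ : ℕ → ℚ
ℕ→ℚ m = mkℚ (+ m) 0 (Coprime.sym (Coprime.1-coprimeTo m))

ℕ→ℚ-mono : ∀ {a b} → a ≤ b → ℕ→ℚ a ≤ℚ ℕ→ℚ b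
ℕ→ℚ-mono {a} {b} a≤b =
  *≤* (subst₂ ℤ._≤_ (sym (ℤ.*-identityʳ (+ a))) (sym (ℤ.*-identityʳ (+ b))) (ℤ.+≤+ a≤b))

ℕ→ℚ-cancel : ∀ {a b} → ℕ→ℚ a ≤ℚ ℕ→ℚ b → a ≤ b
ℕ→ℚ-cancel {a} {b} (*≤* p) =
  ℤ.drop‿+≤+ (subst₂ ℤ._≤_ (ℤ.*-identityʳ (+ a)) (ℤ.*-identityʳ (+ b)) p)

natBox : ∀ {t} (lo hi : Fin t → ℕ) → (∀ i → lo i ≤ hi i) → Box t
natBox lo hi lo≤hi = record
  { lo = λ i → ℕ→ℚ (lo i) ; hi = λ i → ℕ→ℚ (hi i) ; wf = λ i → ℕ→ℚ-mono (lo≤hi i) }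

Overlap : ∀ {t} (lo₁ hi₁ lo₂ hi₂ : Fin t → ℕ) → Set
Overlap lo₁ hi₁ lo₂ hi₂ = ∀ i → lo₁ i ≤ hi₂ i × lo₂ i ≤ hi₁ i

-- Two such boxes meet iff their intervals overlap in every coordinate: the
-- coordinatewise maximum of the lower ends is then a common point.
overlap⇒meet : ∀ {t} {lo₁ hi₁ lo₂ hi₂ : Fin t → ℕ} wf₁ wf₂ →
  Overlap lo₁ hi₁ lo₂ hi₂ → BoxesMeet (natBox lo₁ hi₁ wf₁) (natBox lo₂ hi₂ wf₂)
overlap⇒meet {lo₁ = lo₁} {lo₂ = lo₂} wf₁ wf₂ ov =
  (λ i → ℕ→ℚ (lo₁ i ⊔ lo₂ i)) ,
  (λ i → ℕ→ℚ-mono (m≤m⊔n _ _) , ℕ→ℚ-mono (⊔-lub (wf₁ i) (proj₂ (ov i)))) ,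
  (λ i → ℕ→ℚ-mono (m≤n⊔m _ _) , ℕ→ℚ-mono (⊔-lub (proj₁ (ov i)) (wf₂ i)))

meet⇒overlap : ∀ {t} {lo₁ hi₁ lo₂ hi₂ : Fin t → ℕ} wf₁ wf₂ →
  BoxesMeet (natBox lo₁ hi₁ wf₁) (natBox lo₂ hi₂ wf₂) → Overlap lo₁ hi₁ lo₂ hi₂
meet⇒overlap wf₁ wf₂ (x , x∈₁ , x∈₂) i =
  ℕ→ℚ-cancel (ℚ.≤-trans (proj₁ (x∈₁ i)) (proj₂ (x∈₂ i))) ,
  ℕ→ℚ-cancel (ℚ.≤-trans (proj₁ (x∈₂ i)) (proj₂ (x∈₁ i)))

module Rank {a ℓ₁ ℓ₂} (S : StrictTotalOrder a ℓ₁ ℓ₂) where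
  open StrictTotalOrder S using (compare; <-resp-≈; module Eq)
    renaming (Carrier to A; _<_ to _≺_; _<?_ to _≺?_; trans to ≺-trans; irrefl to ≺-irrefl)

  rank : List A → A → ℕ
  rank [] x = 0
  rank (y ∷ ys) x with y ≺? x
  ... | yes _ = suc (rank ys x)
  ... | no  _ = rank ys x

  rank-mono : ∀ keys {x z} → (∀ {y} → y ≺ x → y ≺ z) → rank keys x ≤ rank keys z
  rank-mono [] down⊆ = z≤n
  rank-mono (y ∷ ys) {x} {z} down⊆ with y ≺? x | y ≺? z
  ... | yes _   | yes _   = s≤s (rank-mono ys down⊆)
  ... | yes y<x | no  y≮z = contradiction (down⊆ y<x) y≮z
  ... | no  _   | yes _   = m≤n⇒m≤1+n (rank-mono ys down⊆)
  ... | no  _   | no  _   = rank-mono ys down⊆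

  rank-≤ : ∀ keys {x z} → ¬ (z ≺ x) → rank keys x ≤ rank keys z
  rank-≤ keys {x} {z} z≮x with compare x z
  ... | tri< x<z _ _ = rank-mono keys (λ y<x → ≺-trans y<x x<z)
  ... | tri≈ _ x≈z _ = rank-mono keys (proj₁ <-resp-≈ x≈z)
  ... | tri> _ _ z<x = contradiction z<x z≮x

  rank-< : ∀ {keys x z} → x ∈ keys → x ≺ z → rank keys x < rank keys z
  rank-< {y ∷ ys} {x} {z} (here refl) x<z with x ≺? x | x ≺? z
  ... | yes x<x | _       = contradiction x<x (≺-irrefl Eq.refl)
  ... | no  _   | yes _   = s≤s (rank-mono ys (λ y<x → ≺-trans y<x x<z))
  ... | no  _   | no  x≮z = contradiction x<z x≮z
  rank-< {y ∷ ys} {x} {z} (there x∈ys) x<z with y ≺? x | y ≺? z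
  ... | yes _   | yes _   = s≤s (rank-< x∈ys x<z)
  ... | yes y<x | no  y≮z = contradiction (≺-trans y<x x<z) y≮z
  ... | no  _   | yes _   = m≤n⇒m≤1+n (rank-< x∈ys x<z)
  ... | no  _   | no  _   = rank-< x∈ys x<z

module _ {A : Set} where

  infix 4 _⊑_
  _⊑_ : List A → List A → Set
  X ⊑ Y = ∃[ Z ] Y ≡ X ++ Z

  ⊑-trans : ∀ {X Y W} → X ⊑ Y → Y ⊑ W → X ⊑ W
  ⊑-trans {X} (Z , refl) (Z′ , refl) = Z ++ Z′ , ++-assoc X Z Z′

  take-⊑ : ∀ i (X : List A) → take i X ⊑ X
  take-⊑ i X = drop i X , sym (take++drop≡id i X)

  take-⊑-branch : ∀ i C (Y : List A) → i ≤ length C → take i (C ++ Y) ⊑ C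
  take-⊑-branch zero    C       Y _         = C , refl
  take-⊑-branch (suc i) (c ∷ C) Y (s≤s i≤C) =
    let Z , eq = take-⊑-branch i C Y i≤C in Z , cong (c ∷_) eq

  take-beyond-branch : ∀ i C (x : A) Y → length C < i → ∃[ Z ] take i (C ++ x ∷ Y) ≡ C ++ x ∷ Z
  take-beyond-branch (suc i) []      x Y _         = take i Y , refl
  take-beyond-branch (suc i) (c ∷ C) x Y (s≤s C<i) =
    let Z , eq = take-beyond-branch i C x Y C<i in Z , cong (c ∷_) eq

  -- Reading W as a root-to-vertex path, ancestor i W is the path to the
  -- ancestor i levels higher (the empty path once i exceeds the depth).
  ancestor : ℕ → List A → List A
  ancestor i W = take (length W ∸ i) W

  ancestor-⊑ : ∀ i W → ancestor i W ⊑ W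
  ancestor-⊑ i W = take-⊑ (length W ∸ i) W

  ancestor-above-branch : ∀ i C Y → length Y ≤ i → ancestor i (C ++ Y) ⊑ C
  ancestor-above-branch i C Y Y≤i = take-⊑-branch _ C Y (begin
    length (C ++ Y) ∸ i         ≡⟨ cong (_∸ i) (length-++ C) ⟩
    (length C + length Y) ∸ i   ≤⟨ ∸-monoˡ-≤ i (+-monoʳ-≤ (length C) Y≤i) ⟩
    (length C + i) ∸ i          ≡⟨ m+n∸n≡m (length C) i ⟩
    length C                    ∎)
    where open ≤-Reasoning

  ancestor-below-branch : ∀ i C (x : A) Y → i < suc (length Y) →
                          ∃[ Z ] ancestor i (C ++ x ∷ Y) ≡ C ++ x ∷ Z
  ancestor-below-branch i C x Y i<Y = take-beyond-branch _ C x Y (begin-strict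
    length C                          <⟨ m<m+n (length C) (m<n⇒0<n∸m i<Y) ⟩
    length C + (suc (length Y) ∸ i)   ≡⟨ +-∸-assoc (length C) (<⇒≤ i<Y) ⟨
    length C + suc (length Y) ∸ i     ≡⟨ cong (_∸ i) (length-++ C) ⟨
    length (C ++ x ∷ Y) ∸ i           ∎)
    where open ≤-Reasoning

infix 4 _<ₗ_
_<ₗ_ : List ℕ → List ℕ → Set
_<ₗ_ = Lex-< _≡_ _<_

lexOrder : StrictTotalOrder _ _ _
lexOrder = Lex.<-strictTotalOrder <-strictTotalOrder

-- Appending a sentinel s (larger than every entry) to D gives a list that
-- is not below any Y comparable with D under the prefix order: D ++ [ s ]
-- is the last list in the lexicographic "subtree" of D.
sentinel-≮ : ∀ {s} D Y {E} → D ⊑ E → Y ⊑ E → All (_< s) E → ¬ (D ++ [ s ] <ₗ Y)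
sentinel-≮ []      (y ∷ Y) _        (_ , refl) (y<s ∷ _) (this s<y)  = <-asym s<y y<s
sentinel-≮ []      (y ∷ Y) _        (_ , refl) (y<s ∷ _) (next refl _) = <-irrefl refl y<s
sentinel-≮ (d ∷ D) (y ∷ Y) (_ , eq) (_ , refl) _ (this d<y) =
  <-irrefl (∷-injectiveˡ (sym eq)) d<y
sentinel-≮ (d ∷ D) (y ∷ Y) (Z , eq) (Z′ , refl) (_ ∷ all<s) (next refl D<Y) =
  sentinel-≮ D Y (Z , ∷-injectiveʳ eq) (Z′ , refl) all<s D<Y

branch-<ₗ : ∀ C {x y} A B → x < y → C ++ x ∷ A <ₗ C ++ y ∷ B
branch-<ₗ []      A B x<y = this x<y
branch-<ₗ (c ∷ C) A B x<y = next refl (branch-<ₗ C A B x<y)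

-- For a root path W with entries below the sentinel s, the interval
-- [ low j W , high s m W ] starts at (the code of) the j-th ancestor and
-- ends after the whole subtree of the m-th ancestor.
low : ℕ → List ℕ → List ℕ
low = ancestor

high : ℕ → ℕ → List ℕ → List ℕ
high s m W = ancestor m W ++ [ s ]

low≤high : ∀ {s} j m W → All (_< s) W → ¬ (high s m W <ₗ low j W)
low≤high j m W = sentinel-≮ (ancestor m W) (ancestor j W) (ancestor-⊑ m W) (ancestor-⊑ j W)

-- Ends of C ++ P and C ++ Q at most j + m + 1 apart have meeting intervals:
-- either |Q| ≤ m, and both relevant ancestors are prefixes of C ++ P, or
-- |P| ≤ j, and both are prefixes of C ++ Q; the sentinel does the rest.
near⇒overlap : ∀ {s} j m C P Q → All (_< s) (C ++ P) → All (_< s) (C ++ Q) →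
               length P + length Q ≤ j + suc m → ¬ (high s m (C ++ Q) <ₗ low j (C ++ P))
near⇒overlap j m C P Q all-P all-Q P+Q≤ with length Q ≤? m
... | yes Q≤m = sentinel-≮ _ _
      (⊑-trans (ancestor-above-branch m C Q Q≤m) (P , refl)) (ancestor-⊑ j (C ++ P)) all-P
... | no  Q≰m = sentinel-≮ _ _
      (ancestor-⊑ m (C ++ Q)) (⊑-trans (ancestor-above-branch j C P P≤j) (Q , refl)) all-Q
  where
  P≤j : length P ≤ j
  P≤j = +-cancelʳ-≤ (suc m) (length P) j
          (≤-trans (+-monoʳ-≤ (length P) (≰⇒> Q≰m)) P+Q≤)

far⇒separated : ∀ {s} j m C {x y} P Q → x < y → m < suc (length P) → j < suc (length Q) →
                high s m (C ++ x ∷ P) <ₗ low j (C ++ y ∷ Q)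
far⇒separated {s} j m C {x} {y} P Q x<y m<P j<Q
  with ancestor-below-branch m C x P m<P | ancestor-below-branch j C y Q j<Q
... | Z , eqₘ | Z′ , eqⱼ rewrite eqₘ | eqⱼ =
  subst (_<ₗ C ++ y ∷ Z′) (sym (++-assoc C (x ∷ Z) [ s ])) (branch-<ₗ C (Z ++ [ s ]) Z′ x<y)

module _ {A : Set} where

  Distinct : List A → Set
  Distinct []       = ⊤
  Distinct (x ∷ xs) = x ∉ xs × Distinct xs

  distinct-++ˡ : ∀ xs ys → Distinct (xs ++ ys) → Distinct xs
  distinct-++ˡ []       ys _          = tt
  distinct-++ˡ (x ∷ xs) ys (x∉ , dist) = (x∉ ∘ ∈-++⁺ˡ) , distinct-++ˡ xs ys dist

  distinct-++ʳ : ∀ xs ys → Distinct (xs ++ ys) → Distinct ys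
  distinct-++ʳ []       ys dist       = dist
  distinct-++ʳ (x ∷ xs) ys (_ , dist) = distinct-++ʳ xs ys dist

  distinct-∷ʳ : ∀ xs y → Distinct xs → y ∉ xs → Distinct (xs ++ [ y ])
  distinct-∷ʳ []       y _           _  = (λ ()) , tt
  distinct-∷ʳ (x ∷ xs) y (x∉ , dist) y∉ = x∉xs∷ʳy , distinct-∷ʳ xs y dist (y∉ ∘ there)
    where
    x∉xs∷ʳy : x ∉ xs ++ [ y ]
    x∉xs∷ʳy x∈ with ∈-++⁻ xs x∈
    ... | inj₁ x∈xs       = x∉ x∈xs
    ... | inj₂ (here x≡y) = y∉ (here (sym x≡y))

  lookup-injective : ∀ xs → Distinct xs → Injective _≡_ _≡_ (lookup xs)
  lookup-injective (x ∷ xs) _          {Fin.zero}  {Fin.zero}  _  = refl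
  lookup-injective (x ∷ xs) (x∉ , _)   {Fin.zero}  {Fin.suc j} eq =
    contradiction (subst (_∈ xs) (sym eq) (∈-lookup j)) x∉
  lookup-injective (x ∷ xs) (x∉ , _)   {Fin.suc i} {Fin.zero}  eq =
    contradiction (subst (_∈ xs) eq (∈-lookup i)) x∉
  lookup-injective (x ∷ xs) (_ , dist) {Fin.suc i} {Fin.suc j} eq =
    cong Fin.suc (lookup-injective xs dist eq)

module Paths {n : ℕ} (T : Graph n) where

  open DecMembership (Fin._≟_ {n}) using (_∈?_)

  data Path : Fin n → Fin n → List (Fin n) → Set where
    stop : ∀ {a} → Path a a [ a ]
    via  : ∀ {a b c xs} → Adj T a b → Path b c xs → Path a c (a ∷ xs)

  SimplePath : Fin n → Fin n → Set
  SimplePath a b = ∃[ xs ] (Path a b xs × Distinct xs)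

  starts-at : ∀ {a b xs} → Path a b xs → ∃[ ys ] xs ≡ a ∷ ys
  starts-at stop      = [] , refl
  starts-at (via _ _) = _ , refl

  starts∈ : ∀ {a b xs} → Path a b xs → a ∈ xs
  starts∈ stop      = here refl
  starts∈ (via _ _) = here refl

  ends∈ : ∀ {a b xs} → Path a b xs → b ∈ xs
  ends∈ stop      = here refl
  ends∈ (via _ p) = there (ends∈ p)

  single-path : ∀ {a b c} → Path a b [ c ] → a ≡ b
  single-path stop = refl

  two-path : ∀ {a b c d} → Path a b (c ∷ d ∷ []) → d ≡ b
  two-path (via _ stop) = refl

  suffix-path : ∀ {a b x zs} ys → Path a b (ys ++ x ∷ zs) → Path x b (x ∷ zs)
  suffix-path []            stop              = stop
  suffix-path []            (via e p)         = via e p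
  suffix-path (y ∷ [])      (via _ stop)      = stop
  suffix-path (y ∷ [])      (via _ (via e p)) = via e p
  suffix-path (y ∷ y′ ∷ ys) (via _ p)         = suffix-path (y′ ∷ ys) p

  prefix-path : ∀ {a b x zs} ys → Path a b (ys ++ x ∷ zs) → Path a x (ys ++ [ x ])
  prefix-path []            stop      = stop
  prefix-path []            (via _ _) = stop
  prefix-path (y ∷ [])      (via e p) = via e (prefix-path [] p)
  prefix-path (y ∷ y′ ∷ ys) (via e p) = via e (prefix-path (y′ ∷ ys) p)

  path-∷ʳ : ∀ {a b c xs} → Path a b xs → Adj T b c → Path a c (xs ++ [ c ])
  path-∷ʳ stop      e = via e stop
  path-∷ʳ (via f p) e = via f (path-∷ʳ p e)

  _++ʷ_ : ∀ {a b c ℓ₁ ℓ₂} → Walk T a b ℓ₁ → Walk T b c ℓ₂ → Walk T a c (ℓ₁ + ℓ₂)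
  here     ++ʷ w′ = w′
  step e w ++ʷ w′ = step e (w ++ʷ w′)

  reverse-walk : ∀ {a b ℓ} → Walk T a b ℓ → Walk T b a ℓ
  reverse-walk here = here
  reverse-walk {ℓ = suc ℓ} (step e w) =
    subst (Walk T _ _) (+-comm ℓ 1) (reverse-walk w ++ʷ step (symm T e) here)

  path→walk : ∀ {a b x xs} → Path a b (x ∷ xs) → Walk T a b (length xs)
  path→walk stop              = here
  path→walk (via e stop)      = step e here
  path→walk (via e (via f p)) = step e (path→walk (via f p))

  -- Shortcutting repeated vertices turns every walk into a simple path.
  walk⇒simple : ∀ {a b ℓ} → Walk T a b ℓ → SimplePath a b
  walk⇒simple {a} here = [ a ] , stop , (λ ()) , tt
  walk⇒simple {a} (step e w) with walk⇒simple w
  ... | xs , p , dist with a ∈? xs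
  ...   | no  a∉ = a ∷ xs , via e p , a∉ , dist
  ...   | yes a∈ with ∈-∃++ a∈
  ...     | ys , zs , refl = a ∷ zs , suffix-path ys p , distinct-++ʳ ys (a ∷ zs) dist

  path-edge : ∀ {a b x xs} → Path a b (x ∷ xs) → (i : Fin (length xs)) →
              Adj T (lookup (x ∷ xs) (Fin.inject₁ i)) (lookup (x ∷ xs) (Fin.suc i))
  path-edge (via e stop)      Fin.zero    = e
  path-edge (via e (via _ _)) Fin.zero    = e
  path-edge (via _ (via f p)) (Fin.suc i) = path-edge (via f p) i

  path-last : ∀ {a b x xs} → Path a b (x ∷ xs) → lookup (x ∷ xs) (Fin.fromℕ (length xs)) ≡ b
  path-last stop              = refl
  path-last (via _ stop)      = refl
  path-last (via _ (via f p)) = path-last (via f p)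

  module _ (acyclic : Acyclic T) where

    no-closing-edge : ∀ {a b x₀ x₁ x₂ rest} → Path a b (x₀ ∷ x₁ ∷ x₂ ∷ rest) →
                      Distinct (x₀ ∷ x₁ ∷ x₂ ∷ rest) → Adj T b a → ⊥
    no-closing-edge {a} {x₀ = x₀} {x₁} {x₂} {rest} p@(via _ _) dist ba = acyclic record
      { m     = length rest
      ; c     = lookup xs
      ; inj   = lookup-injective xs dist
      ; edges = path-edge p
      ; close = subst (λ z → Adj T z a) (sym (path-last p)) ba
      }
      where xs = x₀ ∷ x₁ ∷ x₂ ∷ rest

    path-unique : ∀ {a b xs ys} → Path a b xs → Path a b ys → Distinct xs → Distinct ys → xs ≡ ys
    path-unique stop      stop      _         _         = refl
    path-unique stop      (via _ q) _         (a∉ , _)  = contradiction (ends∈ q) a∉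
    path-unique (via _ p) stop      (a∉ , _)  _         = contradiction (ends∈ p) a∉
    path-unique {a} {b} (via {b = x} {xs = xs} ax p) (via {b = y} {xs = ys} ay q) (a∉xs , dxs) (a∉ys , dys)
      with x Fin.≟ y
    ... | yes refl = cong (a ∷_) (path-unique p q dxs dys)
    ... | no  x≢y with x ∈? ys
    -- Otherwise, if x is not on q, then x, a, y, … is a second simple path
    -- from x to b; by induction it is the rest of the first path, which
    -- would then revisit a.
    ...   | no  x∉ys = contradiction (subst (a ∈_) (sym xs≡x∷a∷ys) (there (here refl))) a∉xs
      where
      x∉a∷ys : x ∉ a ∷ ys
      x∉a∷ys (here refl) = a∉xs (starts∈ p)
      x∉a∷ys (there x∈ys) = x∉ys x∈ys
      xs≡x∷a∷ys : xs ≡ x ∷ a ∷ ys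
      xs≡x∷a∷ys = path-unique p (via (symm T ax) (via ay q)) dxs (x∉a∷ys , a∉ys , dys)
    -- If x is on q, then a, y, …, x is a simple path closed by the edge x a.
    ...   | yes x∈ys with ∈-∃++ x∈ys
    ...     | Y₁ , Y₂ , refl = ⊥-elim (closes Y₁ q dys a∉ys)
      where
      closes : ∀ Y₁ → Path y b (Y₁ ++ x ∷ Y₂) → Distinct (Y₁ ++ x ∷ Y₂) → a ∉ Y₁ ++ x ∷ Y₂ → ⊥
      closes []      q _    _  = x≢y (∷-injectiveˡ (proj₂ (starts-at q)))
      closes (z ∷ Z) q dist a∉ = long-cycle Z (via ay (prefix-path (z ∷ Z) q))
        ((λ a∈ → a∉ (subst (a ∈_) (++-assoc (z ∷ Z) [ x ] Y₂) (∈-++⁺ˡ a∈))) ,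
         distinct-++ˡ ((z ∷ Z) ++ [ x ]) Y₂ (subst Distinct (sym (++-assoc (z ∷ Z) [ x ] Y₂)) dist))
        where
        -- (Z is split only to expose the third vertex of the cycle.)
        long-cycle : ∀ Z → Path a x (a ∷ z ∷ Z ++ [ x ]) → Distinct (a ∷ z ∷ Z ++ [ x ]) → ⊥
        long-cycle []      p dist = no-closing-edge p dist (symm T ax)
        long-cycle (_ ∷ _) p dist = no-closing-edge p dist (symm T ax)

    edge-parent-child : ∀ {r x y P Q} → Adj T x y → Path r x P → Path r y Q →
                        Distinct P → Distinct Q → Q ≡ P ++ [ y ] ⊎ P ≡ Q ++ [ x ]
    edge-parent-child {x = x} {y} {P} {Q} xy p q dP dQ with y ∈? P
    ... | no  y∉P = inj₁ (sym (path-unique (path-∷ʳ p xy) q (distinct-∷ʳ P y dP y∉P) dQ))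
    ... | yes y∈P with ∈-∃++ y∈P
    ...   | A , B , refl = inj₂ (child (suffix-path A p) (distinct-++ʳ A (y ∷ B) dP))
      where
      A∷ʳy≡Q : A ++ [ y ] ≡ Q
      A∷ʳy≡Q = path-unique (prefix-path A p) q
        (distinct-++ˡ (A ++ [ y ]) B (subst Distinct (sym (++-assoc A [ y ] B)) dP)) dQ
      -- The part of P after y is the single edge y x.
      child : ∀ {B} → Path y x (y ∷ B) → Distinct (y ∷ B) → A ++ y ∷ B ≡ Q ++ [ x ]
      child {[]}          yx _    = contradiction (subst (λ z → Adj T z y) (sym (single-path yx)) xy) (irrefl T)
      child {b ∷ []}      yx _    = begin
        A ++ y ∷ b ∷ []     ≡⟨ cong (λ z → A ++ y ∷ z ∷ []) (two-path yx) ⟩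
        A ++ y ∷ x ∷ []     ≡⟨ ++-assoc A [ y ] [ x ] ⟨
        (A ++ [ y ]) ++ [ x ] ≡⟨ cong (_++ [ x ]) A∷ʳy≡Q ⟩
        Q ++ [ x ]          ∎
        where open ≡-Reasoning
      child {_ ∷ _ ∷ _}   yx dist = ⊥-elim (no-closing-edge yx dist xy)

module Branching {A : Set} (_≟_ : DecidableEquality A) where

  -- For root paths P and Q, the number of edges between their ends through
  -- the last common vertex: |P| + |Q| - 2 |longest common prefix|.
  branchDist : List A → List A → ℕ
  branchDist []      Q       = length Q
  branchDist (x ∷ P) []      = suc (length P)
  branchDist (x ∷ P) (y ∷ Q) with x ≟ y
  ... | yes _ = branchDist P Q
  ... | no  _ = suc (length P) + suc (length Q)

  branchDist-≢ : ∀ {x y} P Q → x ≢ y →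
                 branchDist (x ∷ P) (y ∷ Q) ≡ suc (length P) + suc (length Q)
  branchDist-≢ {x} {y} P Q x≢y with x ≟ y
  ... | yes x≡y = contradiction x≡y x≢y
  ... | no  _   = refl

  branchDist-≡ : ∀ x P Q → branchDist (x ∷ P) (x ∷ Q) ≡ branchDist P Q
  branchDist-≡ x P Q with x ≟ x
  ... | yes _   = refl
  ... | no  x≢x = contradiction refl x≢x

  branchDist-self : ∀ P → branchDist P P ≡ 0
  branchDist-self []      = refl
  branchDist-self (x ∷ P) = trans (branchDist-≡ x P P) (branchDist-self P)

  length-∷ʳ : ∀ P (y : A) → length (P ++ [ y ]) ≡ suc (length P)
  length-∷ʳ P y = length-++-comm P [ y ]

  branchDist-∷ʳ-≤ : ∀ P y V → branchDist (P ++ [ y ]) V ≤ suc (branchDist P V)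
  branchDist-∷ʳ-≤ []      y []      = ≤-refl
  branchDist-∷ʳ-≤ []      y (z ∷ V) with y ≟ z
  ... | yes _ = m≤n+m (length V) 2
  ... | no  _ = ≤-refl
  branchDist-∷ʳ-≤ (x ∷ P) y [] rewrite length-∷ʳ P y = ≤-refl
  branchDist-∷ʳ-≤ (x ∷ P) y (z ∷ V) with x ≟ z
  ... | yes _ = branchDist-∷ʳ-≤ P y V
  ... | no  _ rewrite length-∷ʳ P y = ≤-refl

  branchDist-≤-∷ʳ : ∀ P y V → branchDist P V ≤ suc (branchDist (P ++ [ y ]) V)
  branchDist-≤-∷ʳ []      y []      = z≤n
  branchDist-≤-∷ʳ []      y (z ∷ V) with y ≟ z
  ... | yes _ = ≤-refl
  ... | no  _ = s≤s (m≤n+m (length V) 2)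
  branchDist-≤-∷ʳ (x ∷ P) y [] rewrite length-∷ʳ P y = m≤n+m _ 2
  branchDist-≤-∷ʳ (x ∷ P) y (z ∷ V) with x ≟ z
  ... | yes _ = branchDist-≤-∷ʳ P y V
  ... | no  _ rewrite length-∷ʳ P y = m≤n+m _ 2

  data Diverge : List A → List A → Set where
    left-empty   : ∀ {Q} → Diverge [] Q
    right-empty  : ∀ {p P} → Diverge (p ∷ P) []
    heads-differ : ∀ {p q P Q} → p ≢ q → Diverge (p ∷ P) (q ∷ Q)

  same-heads : ∀ {x P Q} → ¬ Diverge (x ∷ P) (x ∷ Q)
  same-heads (heads-differ x≢x) = x≢x refl

  record Branch (P Q : List A) : Set where
    constructor branchAt
    field
      C P′ Q′  : List A
      P≡C++P′  : P ≡ C ++ P′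
      Q≡C++Q′  : Q ≡ C ++ Q′
      diverge  : Diverge P′ Q′
      dist≡    : branchDist P Q ≡ length P′ + length Q′

  branch : ∀ P Q → Branch P Q
  branch []      Q       = branchAt [] [] Q refl refl left-empty refl
  branch (x ∷ P) []      = branchAt [] (x ∷ P) [] refl refl right-empty (sym (+-identityʳ _))
  branch (x ∷ P) (y ∷ Q) with x ≟ y
  ... | no  x≢y = branchAt [] (x ∷ P) (y ∷ Q) refl refl (heads-differ x≢y) (branchDist-≢ P Q x≢y)
  ... | yes refl with branch P Q
  ...   | branchAt C P′ Q′ P≡ Q≡ div dist =
    branchAt (x ∷ C) P′ Q′ (cong (x ∷_) P≡) (cong (x ∷_) Q≡) div (trans (branchDist-≡ x P Q) dist)

module RootedTree {N : ℕ} (T : Graph N) (connected : Connected T) (acyclic : Acyclic T)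
                  (root : Fin N) where
  open Paths T
  open Branching (Fin._≟_ {N})

  rootPath : Fin N → List (Fin N)
  rootPath v = proj₁ (walk⇒simple (proj₂ (connected root v)))

  rootPath-path : ∀ v → Path root v (rootPath v)
  rootPath-path v = proj₁ (proj₂ (walk⇒simple (proj₂ (connected root v))))

  rootPath-distinct : ∀ v → Distinct (rootPath v)
  rootPath-distinct v = proj₂ (proj₂ (walk⇒simple (proj₂ (connected root v))))

  -- Every step of a walk moves to the parent or to a child, changing the
  -- root path by one vertex; so walks are at least as long as branchDist.
  branchDist-≤-walk : ∀ {u v ℓ} → Walk T u v ℓ → branchDist (rootPath u) (rootPath v) ≤ ℓ
  branchDist-≤-walk {u} here = ≤-reflexive (branchDist-self (rootPath u))
  branchDist-≤-walk {u} {v} {suc ℓ} (step {w = w} uw walk)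
    with edge-parent-child acyclic uw (rootPath-path u) (rootPath-path w)
                                      (rootPath-distinct u) (rootPath-distinct w)
  ... | inj₁ πw≡πu∷ʳw = ≤-trans (branchDist-≤-∷ʳ (rootPath u) w (rootPath v))
          (s≤s (subst (λ W → branchDist W (rootPath v) ≤ ℓ) πw≡πu∷ʳw (branchDist-≤-walk walk)))
  ... | inj₂ πu≡πw∷ʳu rewrite πu≡πw∷ʳu =
          ≤-trans (branchDist-∷ʳ-≤ (rootPath w) u (rootPath v)) (s≤s (branchDist-≤-walk walk))

  -- Conversely, going up from u to the branch point and down to v is a walk.
  branch-walk : ∀ {u v C P′ Q′} → rootPath u ≡ C ++ P′ → rootPath v ≡ C ++ Q′ →
                Diverge P′ Q′ → Walk T u v (length P′ + length Q′)
  branch-walk {u} {v} {C} {P′} {Q′} πu≡ πv≡ div with initLast C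
  ... | C₀ ∷ʳ′ c =
    reverse-walk (path→walk (down-to u P′ πu≡)) ++ʷ path→walk (down-to v Q′ πv≡)
    where
    down-to : ∀ x X → rootPath x ≡ (C₀ ++ [ c ]) ++ X → Path c x (c ∷ X)
    down-to x X πx≡ =
      suffix-path C₀ (subst (Path root x) (trans πx≡ (++-assoc C₀ [ c ] X)) (rootPath-path x))
  -- Both root paths start at the root, so they cannot diverge immediately.
  ... | [] with starts-at (rootPath-path u) | starts-at (rootPath-path v)
  ...   | _ , πu≡root∷ | _ , πv≡root∷ =
    ⊥-elim (same-heads (subst₂ Diverge (trans (sym πu≡) πu≡root∷)
                                       (trans (sym πv≡) πv≡root∷) div))

  within⇒branchDist : ∀ {k u v} → DistAtMost T k u v → branchDist (rootPath u) (rootPath v) ≤ k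
  within⇒branchDist (ℓ , ℓ≤k , walk) = ≤-trans (branchDist-≤-walk walk) ℓ≤k

  branchDist⇒within : ∀ {k u v} → branchDist (rootPath u) (rootPath v) ≤ k → DistAtMost T k u v
  branchDist⇒within {k} {u} {v} d≤k with branch (rootPath u) (rootPath v)
  ... | branchAt C P′ Q′ πu≡ πv≡ div dist≡ =
    length P′ + length Q′ , subst (_≤ k) dist≡ d≤k , branch-walk πu≡ πv≡ div

-- Coordinate t of k pairs the j-th ancestor with the m-th, where j + m + 1 = k.
complement-sum : ∀ k (t : Fin k) → toℕ t + suc (k ∸ suc (toℕ t)) ≡ k
complement-sum k t = trans (+-suc (toℕ t) _) (m+[n∸m]≡n (toℕ<n t))

choose-coordinate : ∀ k a b → 1 ≤ k → 0 < a → 0 < b → k < a + b →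
                    ∃[ j ] (j < k × j < b × k ∸ suc j < a)
choose-coordinate k a (suc b) _ _ _ k<a+b with suc b ≤? k
... | yes b<k = b , b<k , ≤-refl ,
        +-cancelʳ-< (suc b) (k ∸ suc b) a (subst (_< a + suc b) (sym (m∸n+n≡m b<k)) k<a+b)
choose-coordinate (suc k) a (suc b) _ 0<a _ _ | no b≮k =
  k , ≤-refl , ≤-trans (n≤1+n (suc k)) (≰⇒> b≮k) , subst (_< a) (sym (n∸n≡0 k)) 0<a

depth-close : ∀ {A : Set} (C P Q : List A) k → length P + length Q ≤ k →
              length (C ++ P) ≤ length (C ++ Q) + k
depth-close C P Q k P+Q≤k = begin
  length (C ++ P)              ≡⟨ length-++ C ⟩
  length C + length P          ≤⟨ +-monoʳ-≤ (length C) (≤-trans (m≤m+n (length P) (length Q))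
                                   (≤-trans P+Q≤k (m≤n+m k (length Q)))) ⟩
  length C + (length Q + k)    ≡⟨ +-assoc (length C) (length Q) k ⟨
  length C + length Q + k      ≡⟨ cong (_+ k) (length-++ C) ⟨
  length (C ++ Q) + k          ∎
  where open ≤-Reasoning

depth-below : ∀ {A : Set} (C Q : List A) k → length (C ++ Q) ≤ length C + k → length Q ≤ k
depth-below C Q k CQ≤C+k =
  +-cancelˡ-≤ (length C) (length Q) k (subst (_≤ length C + k) (length-++ C) CQ≤C+k)

module Representation {N : ℕ} (T : Graph N) (connected : Connected T) (acyclic : Acyclic T)
                      (root : Fin N) (k : ℕ) where
  open RootedTree T connected acyclic root
  open Branching (Fin._≟_ {N})
  open Rank lexOrder

  -- Root paths encoded as lists of naturals below the sentinel N.
  code : Fin N → List ℕ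
  code v = map toℕ (rootPath v)

  code<N : ∀ v → All (_< N) (code v)
  code<N v = AllP.map⁺ (All.universal toℕ<n (rootPath v))

  code-split : ∀ {v} C X → rootPath v ≡ C ++ X → code v ≡ map toℕ C ++ map toℕ X
  code-split C X πv≡ = trans (cong (map toℕ) πv≡) (map-++ toℕ C X)

  lowKey highKey : Fin N → Fin k → List ℕ
  lowKey  v t = low (toℕ t) (code v)
  highKey v t = high N (k ∸ suc (toℕ t)) (code v)

  -- Only the right endpoints need to be ranked strictly.
  keys : List (List ℕ)
  keys = cartesianProductWith highKey (allFin N) (allFin k)

  highKey∈keys : ∀ v t → highKey v t ∈ keys
  highKey∈keys v t = ∈-cartesianProductWith⁺ highKey (∈-allFin v) (∈-allFin t)

  lower upper : Fin N → Fin (suc k) → ℕ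
  lower v Fin.zero    = length (rootPath v)
  lower v (Fin.suc t) = rank keys (lowKey v t)
  upper v Fin.zero    = length (rootPath v) + k
  upper v (Fin.suc t) = rank keys (highKey v t)

  lower≤upper : ∀ v i → lower v i ≤ upper v i
  lower≤upper v Fin.zero    = m≤m+n _ k
  lower≤upper v (Fin.suc t) = rank-≤ keys (low≤high (toℕ t) (k ∸ suc (toℕ t)) (code v) (code<N v))

  box : Fin N → Box (suc k)
  box v = natBox (lower v) (upper v) (lower≤upper v)

  near⇒lower≤upper : ∀ {u v} C P Q → rootPath u ≡ C ++ P → rootPath v ≡ C ++ Q →
                     length P + length Q ≤ k → ∀ i → lower u i ≤ upper v i
  near⇒lower≤upper C P Q πu≡ πv≡ P+Q≤k Fin.zero =
    subst₂ (λ a b → a ≤ b + k) (cong length (sym πu≡)) (cong length (sym πv≡))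
      (depth-close C P Q k P+Q≤k)
  near⇒lower≤upper {u} {v} C P Q πu≡ πv≡ P+Q≤k (Fin.suc t) = rank-≤ keys
    (subst₂ (λ X Y → ¬ (high N m Y <ₗ low j X)) (sym (code-split C P πu≡)) (sym (code-split C Q πv≡))
      (near⇒overlap j m (map toℕ C) (map toℕ P) (map toℕ Q)
        (subst (All (_< N)) (code-split C P πu≡) (code<N u))
        (subst (All (_< N)) (code-split C Q πv≡) (code<N v))
        (subst₂ (λ a b → a + b ≤ j + suc m) (sym (length-map toℕ P)) (sym (length-map toℕ Q))
          (subst (length P + length Q ≤_) (sym (complement-sum k t)) P+Q≤k))))
    where
    j = toℕ t
    m = k ∸ suc j

  far⇒separated-coordinate : ∀ {u v C p q P Q} → 1 ≤ k →
    rootPath u ≡ C ++ p ∷ P → rootPath v ≡ C ++ q ∷ Q → toℕ p < toℕ q →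
    k < suc (length P) + suc (length Q) → ∃[ i ] upper u i < lower v i
  far⇒separated-coordinate {u} {v} {C} {p} {q} {P} {Q} 1≤k πu≡ πv≡ p<q far
    with choose-coordinate k (suc (length P)) (suc (length Q)) 1≤k (s≤s z≤n) (s≤s z≤n) far
  ... | j , j<k , j<Q , m<P = Fin.suc t , rank-< (highKey∈keys u t)
    (subst (λ j → high N (k ∸ suc j) (code u) <ₗ low j (code v)) (sym (toℕ-fromℕ< j<k)) separated)
    where
    t = Fin.fromℕ< j<k
    separated : high N (k ∸ suc j) (code u) <ₗ low j (code v)
    separated rewrite code-split C (p ∷ P) πu≡ | code-split C (q ∷ Q) πv≡ =
      far⇒separated j (k ∸ suc j) (map toℕ C) (map toℕ P) (map toℕ Q) p<q
        (subst (λ l → k ∸ suc j < suc l) (sym (length-map toℕ P)) m<P)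
        (subst (λ l → j < suc l) (sym (length-map toℕ Q)) j<Q)

  depth-overlap⇒near : ∀ {u v} C Q → rootPath u ≡ C ++ [] → rootPath v ≡ C ++ Q →
                       lower v Fin.zero ≤ upper u Fin.zero → length Q ≤ k
  depth-overlap⇒near C Q πu≡ πv≡ lv≤uu = depth-below C Q k
    (subst₂ (λ a b → a ≤ b + k) (cong length πv≡) (cong length (trans πu≡ (++-identityʳ C))) lv≤uu)

  within⇒overlap : ∀ {u v} → DistAtMost T k u v → Overlap (lower u) (upper u) (lower v) (upper v)
  within⇒overlap {u} {v} close with branch (rootPath u) (rootPath v)
  ... | branchAt C P Q πu≡ πv≡ _ dist≡ =
    λ i → near⇒lower≤upper C P Q πu≡ πv≡ P+Q≤k i ,
          near⇒lower≤upper C Q P πv≡ πu≡ (subst (_≤ k) (+-comm (length P) _) P+Q≤k) i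
    where
    P+Q≤k : length P + length Q ≤ k
    P+Q≤k = subst (_≤ k) dist≡ (within⇒branchDist close)

  overlap⇒within : ∀ {u v} → 1 ≤ k → Overlap (lower u) (upper u) (lower v) (upper v) →
                   DistAtMost T k u v
  overlap⇒within {u} {v} 1≤k ov with branch (rootPath u) (rootPath v)
  ... | branchAt C P Q πu≡ πv≡ div dist≡ with length P + length Q ≤? k
  ...   | yes P+Q≤k = branchDist⇒within (subst (_≤ k) (sym dist≡) P+Q≤k)
  ...   | no  P+Q≰k = ⊥-elim (apart div πu≡ πv≡ (≰⇒> P+Q≰k))
    where
    -- More than k apart: if one is an ancestor of the other the depth
    -- coordinate separates them, otherwise some key coordinate does.
    apart : ∀ {P Q} → Diverge P Q → rootPath u ≡ C ++ P → rootPath v ≡ C ++ Q →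
            k < length P + length Q → ⊥
    apart {Q = Q} left-empty  πu≡ πv≡ far =
      <⇒≱ far (depth-overlap⇒near C Q πu≡ πv≡ (proj₂ (ov Fin.zero)))
    apart {P = P} right-empty πu≡ πv≡ far =
      <⇒≱ (subst (k <_) (+-identityʳ _) far) (depth-overlap⇒near C P πv≡ πu≡ (proj₁ (ov Fin.zero)))
    apart {p ∷ P} {q ∷ Q} (heads-differ p≢q) πu≡ πv≡ far with <-cmp (toℕ p) (toℕ q)
    ... | tri< p<q _ _ =
      let i , hiu<lov = far⇒separated-coordinate 1≤k πu≡ πv≡ p<q far
      in <⇒≱ hiu<lov (proj₂ (ov i))
    ... | tri≈ _ p≡q _ = p≢q (toℕ-injective p≡q)
    ... | tri> _ _ q<p =
      let i , hiv<lou = far⇒separated-coordinate 1≤k πv≡ πu≡ q<p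
                          (subst (k <_) (+-comm (suc (length P)) _) far)
      in <⇒≱ hiv<lou (proj₁ (ov i))

  representation : 1 ≤ k → BoxRepresentation (power T k) (suc k)
  representation 1≤k = box , λ u v u≢v →
    (λ { (_ , close) → overlap⇒meet (lower≤upper u) (lower≤upper v) (within⇒overlap close) }) ,
    (λ meet → u≢v , overlap⇒within 1≤k (meet⇒overlap (lower≤upper u) (lower≤upper v) meet))

theorem1 : ∀ {n : ℕ} (T : Graph n) (k : ℕ) → IsTree T → 1 ≤ k → BoxicityAtMost (power T k) (k + 1)
theorem1 T k (1≤n , connected , acyclic) 1≤k =
  suc k , ≤-reflexive (+-comm 1 k) ,
  Representation.representation T connected acyclic (Fin.fromℕ< 1≤n) k 1≤k
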